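{- There exist infinitely many trees $T$ such that, with $n=|V(T)|$, $\mathrm{th}_{\mathrm{H}}(T)>\lceil 2\sqrt{n-1}\rceil$.
   Context: All graphs are finite, simple and undirected; $N(v)$ is the open neighborhood of $v$. Vertices are colored blue or white. Under the hopping color change rule, a blue vertex $v$ may force a white vertex $w$ (not necessarily adjacent to $v$) to become blue provided $v$ has not previously performed a force and every vertex of $N(v)$ is blue. Starting from an initial blue set $B\subseteq V(G)$, a chronological list of forces is a sequence of valid forces performed one at a time until no further force is possible; its unordered set of forces is a set of forces of $B$. $B$ is a hopping forcing set if some chronological list turns every vertex blue. For a set of forces $\mathcal F$ of $B$, put $\mathcal F^{(0)}=B$ and, for $t>0$, let $\mathcal F^{(t)}$ be the set of vertices $w$ for which there is a force $v\to w$ in $\mathcal F$ with $v\in\bigcup_{i<t}\mathcal F^{(i)}$ that is a valid hopping force when exactly the vertices of $\bigcup_{i<t}\mathcal F^{(i)}$ are blue. $\mathrm{pt}_{\mathrm{H}}(G;\mathcal F)$ is the least $t$ with $\bigcup_{i\le t}\mathcal F^{(i)}=V(G)$, and $\mathrm{pt}_{\mathrm{H}}(G;B)$ is the minimum of $\mathrm{pt}_{\mathrm{H}}(G;\mathcal F)$ over sets of forces $\mathcal F$ of $B$ ($\infty$ if $B$ is not a hopping forcing set). The hopping throttling number is $\mathrm{th}_{\mathrm{H}}(G)=\min_{B\subseteq V(G)}\big(|B|+\mathrm{pt}_{\mathrm{H}}(G;B)\big)$. -}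

module Defs where

open import Data.Nat using (ℕ; zero; suc; _+_; _*_; _≤_; _<_)
open import Data.Bool using (Bool; true; false)
open import Data.Fin using (Fin)
open import Data.Fin.Subset using (Subset; _∈_; _∉_; ⁅_⁆; _∪_; ∣_∣)
  renaming (⊥ to ∅)
open import Data.List using (List; []; _∷_; _++_; length)
open import Data.List.Membership.Propositional using () renaming (_∈_ to _∈ₗ_)
open import Data.Unit using (⊤)
open import Data.List.Relation.Unary.Unique.Propositional using (Unique)
open import Data.Product using (Σ; _×_; _,_)
open import Data.Sum using (_⊎_)
open import Relation.Binary.PropositionalEquality using (_≡_)
open import Relation.Nullary using (¬_)

record SimpleGraph (n : ℕ) : Set where
  field
    adj    : Fin n → Fin n → Bool
    sym    : ∀ u v → adj u v ≡ adj v u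
    irrefl : ∀ v → adj v v ≡ false

open SimpleGraph public

Adj : ∀ {n} → SimpleGraph n → Fin n → Fin n → Set
Adj G u v = adj G u v ≡ true

data Walk {n} (G : SimpleGraph n) : Fin n → Fin n → Set where
  here  : ∀ {u} → Walk G u u
  there : ∀ {u v w} → Adj G u v → Walk G v w → Walk G u w

Connected : ∀ {n} → SimpleGraph n → Set
Connected G = ∀ u v → Walk G u v

Chain : ∀ {n} → SimpleGraph n → List (Fin n) → Set
Chain G []           = ⊤
Chain G (x ∷ [])     = ⊤
Chain G (x ∷ y ∷ xs) = Adj G x y × Chain G (y ∷ xs)

HasCycle : ∀ {n} → SimpleGraph n → Set
HasCycle {n} G =
  Σ (Fin n) λ x → Σ (List (Fin n)) λ xs →
    2 ≤ length xs × Unique (x ∷ xs) × Chain G (x ∷ xs ++ x ∷ [])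

IsTree : ∀ {n} → SimpleGraph n → Set
IsTree {n} G = 1 ≤ n × Connected G × ¬ HasCycle G

Force : ℕ → Set
Force n = Fin n × Fin n   -- (v , w) stands for v → w

-- v → w is a valid hopping force when the blue set is `blue` and the
-- vertices that have already forced are `used`
ValidForce : ∀ {n} → SimpleGraph n → Subset n → Subset n → Fin n → Fin n → Set
ValidForce G blue used v w =
  v ∈ blue × v ∉ used × w ∉ blue × (∀ u → Adj G v u → u ∈ blue)

data Chron {n} (G : SimpleGraph n) : Subset n → Subset n → List (Force n) → Set where
  done : ∀ {b u} → (∀ v w → ¬ ValidForce G b u v w) → Chron G b u []
  step : ∀ {b u v w L} → ValidForce G b u v w →
         Chron G (b ∪ ⁅ w ⁆) (u ∪ ⁅ v ⁆) L → Chron G b u ((v , w) ∷ L)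

-- F is (the list of elements of) a set of forces of B
SetOfForces : ∀ {n} → SimpleGraph n → Subset n → List (Force n) → Set
SetOfForces G B F = Chron G B ∅ F

-- BlueBy G B F t x : x ∈ ⋃_{i ≤ t} F^(i)
BlueBy : ∀ {n} → SimpleGraph n → Subset n → List (Force n) → ℕ → Fin n → Set
BlueBy G B F zero    x = x ∈ B
BlueBy {n} G B F (suc t) x =
  BlueBy G B F t x ⊎
  Σ (Fin n) λ v → ((v , x) ∈ₗ F) × BlueBy G B F t v ×
                  (∀ u → Adj G v u → BlueBy G B F t u)

AllBlueBy : ∀ {n} → SimpleGraph n → Subset n → List (Force n) → ℕ → Set
AllBlueBy G B F t = ∀ x → BlueBy G B F t x

IsPtF : ∀ {n} → SimpleGraph n → Subset n → List (Force n) → ℕ → Set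
IsPtF G B F t = AllBlueBy G B F t × (∀ t' → t' < t → ¬ AllBlueBy G B F t')

-- pt_H(G; B) = t  (finite value; B a hopping forcing set)
IsPtB : ∀ {n} → SimpleGraph n → Subset n → ℕ → Set
IsPtB {n} G B t =
  (Σ (List (Force n)) λ F → SetOfForces G B F × IsPtF G B F t) ×
  (∀ F t' → SetOfForces G B F → IsPtF G B F t' → t ≤ t')

-- th_H(G) = th  (sets B with pt_H(G;B) = ∞ do not affect the minimum)
IsHoppingThrottling : ∀ {n} → SimpleGraph n → ℕ → Set
IsHoppingThrottling {n} G th =
  (Σ (Subset n) λ B → Σ ℕ λ t → IsPtB G B t × ∣ B ∣ + t ≡ th) ×
  (∀ B t → IsPtB G B t → th ≤ ∣ B ∣ + t)

IsCeilSqrt : ℕ → ℕ → Set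
IsCeilSqrt m k = m ≤ k * k × (∀ j → m ≤ j * j → k ≤ j)

{-# OPTIONS --safe #-}
-- Write s(i) and a(i) for the numbers of blue vertices and of active vertices (blue with all
-- neighbours blue) after round i, and β = s(0).  A vertex that is blue after round i + 1 but not
-- initially was forced by an active vertex of round i, and distinct such vertices have distinct
-- forcers, so s(i + 1) ≤ β + a(i).  In a connected graph a blue set that is neither empty nor
-- everything contains a blue vertex with a white neighbour, so a(i) < s(i) before the last round;
-- hence n + t ≤ β(t + 1), and for n = k² + 1 AM–GM gives β + t ≥ 2k, with equality only if
-- β = k + 1 and t = k − 1.  The witnesses are spiders with d = (2p + 1)² legs of length 4, so
-- n − 1 = 4d = k² with k = 2(2p + 1).  There, a blue set of size k + 1 has two non-active vertices
-- (its legs cannot all be full or empty since k is not a multiple of 4), which rules out equality.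
-- Conversely, starting from the centre and p + 1 full legs and copying every leg onto the leg p + 1
-- places further on makes everything blue after 4p rounds, so th_H = 2k + 1.
module Submission where

open import Defs hiding (sym)
open import Data.Nat using (ℕ; zero; suc; _+_; _*_; _∸_; _≤_; _<_; z≤n; s≤s; _≤?_; _<?_)
open import Data.Nat.Properties
open import Data.Nat.Divisibility using (_∣_; _∣?_; _∣0; ∣m∣n⇒∣m+n; ∣m+n∣m⇒∣n; n∣m*n; ∣⇒≤)
open import Data.Nat.Solver using (module +-*-Solver)
open import Data.Bool using (Bool; true; false; T; T?; _∧_; _∨_; if_then_else_)
open import Data.Bool.Properties using (∨-comm; T-≡; T-∨; T-∧)
import Data.Bool as Bool
open import Data.Fin using (Fin; zero; suc; toℕ; fromℕ<; inject₁; combine; remQuot; _↑ˡ_; _↑ʳ_)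
import Data.Fin as Fin
open import Data.Fin.Patterns using (0F; 1F; 2F; 3F)
open import Data.Fin.Properties
  using (any?; all?; ¬∀⟶∃¬; toℕ<n; toℕ-injective; toℕ-fromℕ<; toℕ-inject₁;
         toℕ-combine; remQuot-combine; combine-remQuot; combine-injectiveˡ; combine-injectiveʳ)
import Data.Fin.Properties as Finₚ
open import Data.Fin.Subset using (Subset; _∈_; _∉_; ⁅_⁆; _∪_; ∣_∣; inside; outside)
open import Data.Fin.Subset.Properties using (_∈?_; x∈p∪q⁺; x∈p∪q⁻; x∈⁅x⁆; x∈⁅y⁆⇒x≡y; ∉⊥)
open import Data.Vec using ([]; _∷_)
import Data.Vec as Vec
open import Data.List using (List; []; _∷_; _++_)
open import Data.List.Membership.Propositional using () renaming (_∈_ to _∈ₗ_)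
import Data.List.Membership.DecPropositional as DecMembership
open import Data.List.Relation.Unary.Any using (Any; here; there)
open import Data.List.Relation.Unary.All as All using (All; _∷_; [])
open import Data.List.Relation.Unary.All.Properties using (++⁻ʳ; All¬⇒¬Any)
open import Data.List.Relation.Unary.AllPairs using (AllPairs; _∷_; [])
import Data.List.Relation.Unary.AllPairs.Properties as AllPairs
open import Data.List.Relation.Unary.Linked as Linked using (Linked; _∷_; [-])
open import Data.List.Relation.Unary.Linked.Properties using (Linked⇒All)
open import Data.Maybe using (Maybe; just; nothing)
open import Data.Maybe.Properties using (just-injective)
open import Data.Product using (Σ; ∃; _×_; _,_; proj₁; uncurry)
open import Data.Product.Properties using (≡-dec)
open import Data.Sum using (_⊎_; inj₁; inj₂)
open import Data.Unit using (⊤; tt)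
open import Function using (_∘_; id; flip; case_of_; Equivalence)
open import Relation.Nullary using (Dec; yes; no; does; ¬_; contradiction; _×-dec_; _⊎-dec_; _→-dec_)
open import Relation.Nullary.Decidable using (⌊_⌋; toWitness; fromWitness; dec-true; dec-false; map′; from-yes)
open import Relation.Unary using (Pred; Decidable)
open import Relation.Binary.PropositionalEquality
  using (_≡_; _≢_; refl; sym; trans; cong; cong₂; subst; subst₂; module ≡-Reasoning)
open import Algebra.Properties.CommutativeMonoid.Sum +-0-commutativeMonoid using (sum; ∑-distrib-+; ∑-comm)
open import Algebra.Properties.Semiring.Sum +-*-semiring using (*-distribˡ-sum)

open +-*-Solver using (solve; _:+_; _:*_; _:=_; con)

⟨_⟩ : Bool → ℕ
⟨ b ⟩ = if b then 1 else 0

⟨⟩-T : ∀ {b} → T b → ⟨ b ⟩ ≡ 1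
⟨⟩-T {true} _ = refl

⟦_⟧ : ∀ {p} {P : Set p} → Dec P → ℕ
⟦ P? ⟧ = ⟨ does P? ⟩

⟦⟧-mono : ∀ {p q} {P : Set p} {Q : Set q} (P? : Dec P) (Q? : Dec Q) → (P → Q) → ⟦ P? ⟧ ≤ ⟦ Q? ⟧
⟦⟧-mono (no _)  _       _   = z≤n
⟦⟧-mono (yes _) (yes _) _   = ≤-refl
⟦⟧-mono (yes p) (no ¬q) p→q = contradiction (p→q p) ¬q

⟦⟧-⊎ : ∀ {p q r} {P : Set p} {Q : Set q} {R : Set r} (P? : Dec P) (Q? : Dec Q) (R? : Dec R) →
       (P → Q ⊎ R) → ⟦ P? ⟧ ≤ ⟦ Q? ⟧ + ⟦ R? ⟧
⟦⟧-⊎ (no _)  _  _  _       = z≤n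
⟦⟧-⊎ (yes p) Q? R? p→q⊎r with p→q⊎r p
... | inj₁ q = ≤-trans (⟦⟧-mono (yes p) Q? λ _ → q) (m≤m+n _ _)
... | inj₂ r = ≤-trans (⟦⟧-mono (yes p) R? λ _ → r) (m≤n+m _ _)

⟦⟧-≤1 : ∀ {p} {P : Set p} (P? : Dec P) → ⟦ P? ⟧ ≤ 1
⟦⟧-≤1 (yes _) = ≤-refl
⟦⟧-≤1 (no _)  = z≤n

sum-mono : ∀ {n} {f g : Fin n → ℕ} → (∀ x → f x ≤ g x) → sum f ≤ sum g
sum-mono {zero}  f≤g = z≤n
sum-mono {suc n} f≤g = +-mono-≤ (f≤g zero) (sum-mono (f≤g ∘ suc))

sum-<-or-all : ∀ {n p} {P : Fin n → Set p} (f g : Fin n → ℕ) → (∀ x → f x ≤ g x) →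
               (∀ x → f x < g x ⊎ P x) → sum f < sum g ⊎ (∀ x → P x)
sum-<-or-all {zero}  f g f≤g <-or-P = inj₂ λ ()
sum-<-or-all {suc n} f g f≤g <-or-P with <-or-P zero
... | inj₁ f₀<g₀ = inj₁ (+-mono-<-≤ f₀<g₀ (sum-mono (f≤g ∘ suc)))
... | inj₂ P₀ with sum-<-or-all (f ∘ suc) (g ∘ suc) (f≤g ∘ suc) (<-or-P ∘ suc)
...   | inj₁ rest< = inj₁ (+-mono-≤-< (f≤g zero) rest<)
...   | inj₂ Prest = inj₂ λ { zero → P₀ ; (suc x) → Prest x }

term≤sum : ∀ {n} (f : Fin n → ℕ) x → f x ≤ sum f
term≤sum f zero    = m≤m+n _ _
term≤sum f (suc x) = ≤-trans (term≤sum (f ∘ suc) x) (m≤n+m _ (f zero))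

sum-const : ∀ n {c} (f : Fin n → ℕ) → (∀ x → f x ≡ c) → sum f ≡ n * c
sum-const zero    f f≡c = refl
sum-const (suc n) f f≡c = cong₂ _+_ (f≡c zero) (sum-const n (f ∘ suc) (f≡c ∘ suc))

sum-∣ : ∀ {n m} (f : Fin n → ℕ) → (∀ x → m ∣ f x) → m ∣ sum f
sum-∣ {zero}  f m∣f = _ ∣0
sum-∣ {suc n} f m∣f = ∣m∣n⇒∣m+n (m∣f zero) (sum-∣ (f ∘ suc) (m∣f ∘ suc))

sum-↑ : ∀ a {b} (f : Fin (a + b) → ℕ) → sum f ≡ sum (f ∘ (_↑ˡ b)) + sum (f ∘ (a ↑ʳ_))
sum-↑ zero    f = refl
sum-↑ (suc a) f = trans (cong (f zero +_) (sum-↑ a (f ∘ suc))) (sym (+-assoc (f zero) _ _))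

sum-combine : ∀ m {k} (f : Fin (m * k) → ℕ) → sum f ≡ sum (λ i → sum (λ j → f (combine {m} {k} i j)))
sum-combine zero        f = refl
sum-combine (suc m) {k} f =
  trans (sum-↑ k f) (cong (sum (λ j → f (j ↑ˡ (m * k))) +_) (sum-combine m (f ∘ (k ↑ʳ_))))

count : ∀ {n p} {P : Pred (Fin n) p} → Decidable P → ℕ
count P? = sum (λ x → ⟦ P? x ⟧)

count≤n : ∀ {n p} {P : Pred (Fin n) p} (P? : Decidable P) → count P? ≤ n
count≤n {zero}  P? = z≤n
count≤n {suc n} P? = +-mono-≤ (⟦⟧-≤1 (P? zero)) (count≤n (P? ∘ suc))

count<n : ∀ {n p} {P : Pred (Fin n) p} (P? : Decidable P) {x} → ¬ P x → count P? < n
count<n P? {zero} ¬px with P? zero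
... | yes px = contradiction px ¬px
... | no  _  = s≤s (count≤n (P? ∘ suc))
count<n P? {suc x} ¬px = +-mono-≤-< (⟦⟧-≤1 (P? zero)) (count<n (P? ∘ suc) ¬px)

count-all : ∀ {n p} {P : Pred (Fin n) p} (P? : Decidable P) → (∀ x → P x) → count P? ≡ n
count-all {zero}  P? all = refl
count-all {suc n} P? all with P? zero
... | yes _  = cong suc (count-all (P? ∘ suc) (all ∘ suc))
... | no ¬p₀ = contradiction (all zero) ¬p₀

count-none : ∀ {n p} {P : Pred (Fin n) p} (P? : Decidable P) → (∀ x → ¬ P x) → count P? ≡ 0
count-none {zero}  P? none = refl
count-none {suc n} P? none with P? zero
... | yes p₀ = contradiction p₀ (none zero)
... | no  _  = count-none (P? ∘ suc) (none ∘ suc)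

count≤1 : ∀ {n p} {P : Pred (Fin n) p} (P? : Decidable P) → (∀ {x y} → P x → P y → x ≡ y) → count P? ≤ 1
count≤1 {zero}  P? unique = z≤n
count≤1 {suc n} P? unique with P? zero
... | yes p₀ = ≤-reflexive (cong suc (count-none (P? ∘ suc) λ x p → Finₚ.0≢1+n (unique p₀ p)))
... | no  _  = count≤1 (P? ∘ suc) λ p q → Finₚ.suc-injective (unique p q)

count-∈ : ∀ {n} (p : Subset n) → count (_∈? p) ≡ ∣ p ∣
count-∈ []            = refl
count-∈ (inside ∷ p)  = cong suc (count-∈ p)
count-∈ (outside ∷ p) = count-∈ p

count-witness : ∀ {n p} {P : Pred (Fin n) p} (P? : Decidable P) → 0 < count P? → ∃ P
count-witness P? 0<count with any? P?
... | yes witness = witness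
... | no  none    = contradiction (count-none P? λ x px → none (x , px)) (>⇒≢ 0<count)

count-mono : ∀ {n p q} {P : Pred (Fin n) p} {Q : Pred (Fin n) q} (P? : Decidable P) (Q? : Decidable Q) →
             (∀ {x} → P x → Q x) → count P? ≤ count Q?
count-mono P? Q? P⊆Q = sum-mono λ x → ⟦⟧-mono (P? x) (Q? x) P⊆Q

count-mono-< : ∀ {n p q} {P : Pred (Fin n) p} {Q : Pred (Fin n) q} (P? : Decidable P) (Q? : Decidable Q) →
               (∀ {x} → P x → Q x) → ∀ {x} → Q x → ¬ P x → count P? < count Q?
count-mono-< P? Q? P⊆Q {zero} qx ¬px with P? zero | Q? zero
... | yes px | _     = contradiction px ¬px
... | no  _  | no ¬q = contradiction qx ¬q
... | no  _  | yes _ = s≤s (count-mono (P? ∘ suc) (Q? ∘ suc) P⊆Q)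
count-mono-< P? Q? P⊆Q {suc x} qx ¬px =
  +-mono-≤-< (⟦⟧-mono (P? zero) (Q? zero) P⊆Q) (count-mono-< (P? ∘ suc) (Q? ∘ suc) P⊆Q qx ¬px)

module _ {n p q} {P : Pred (Fin n) p} {Q : Pred (Fin n) q} (P? : Decidable P) (Q? : Decidable Q) where

  count-⊆-∪ : ∀ {r} {R : Pred (Fin n) r} (R? : Decidable R) → (∀ {x} → P x → Q x ⊎ R x) →
              count P? ≤ count Q? + count R?
  count-⊆-∪ R? P⊆Q∪R = begin
    count P?                          ≤⟨ sum-mono (λ x → ⟦⟧-⊎ (P? x) (Q? x) (R? x) P⊆Q∪R) ⟩
    sum (λ x → ⟦ Q? x ⟧ + ⟦ R? x ⟧)   ≡⟨ ∑-distrib-+ (λ x → ⟦ Q? x ⟧) (λ x → ⟦ R? x ⟧) ⟩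
    count Q? + count R?               ∎
    where open ≤-Reasoning

  count≤-by-injection : ∀ {r} {R : Fin n → Fin n → Set r} (R? : ∀ v x → Dec (R v x)) →
    (∀ {x} → P x → ∃ λ v → R v x × Q v) → (∀ {v x y} → R v x → R v y → x ≡ y) → count P? ≤ count Q?
  count≤-by-injection R? covered functional = begin
    count P?                                          ≤⟨ sum-mono hit ⟩
    sum (λ x → sum (λ v → ⟦ R? v x ×-dec Q? v ⟧))     ≡⟨ ∑-comm (λ x v → ⟦ R? v x ×-dec Q? v ⟧) ⟩
    sum (λ v → sum (λ x → ⟦ R? v x ×-dec Q? v ⟧))     ≤⟨ sum-mono (λ v → image≤1 v (Q? v)) ⟩
    count Q?                                          ∎
    where
    open ≤-Reasoning
    hit : ∀ x → ⟦ P? x ⟧ ≤ sum (λ v → ⟦ R? v x ×-dec Q? v ⟧)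
    hit x with P? x
    ... | no  _  = z≤n
    ... | yes px with covered px
    ...   | v , rvx , qv = ≤-trans (⟦⟧-mono (yes px) (R? v x ×-dec Q? v) λ _ → rvx , qv)
                                   (term≤sum (λ v → ⟦ R? v x ×-dec Q? v ⟧) v)
    image≤1 : ∀ v (Qv? : Dec (Q v)) → count (λ x → R? v x ×-dec Qv?) ≤ ⟦ Qv? ⟧
    image≤1 v (yes q) = count≤1 (λ x → R? v x ×-dec yes q) λ (rvx , _) (rvy , _) → functional rvx rvy
    image≤1 v (no ¬q) = ≤-reflexive (count-none (λ x → R? v x ×-dec no ¬q) λ x (_ , q) → ¬q q)

telescope : ∀ (s : ℕ → ℕ) {c e} t → (∀ i → i < t → s (suc i) + e ≤ c + s i) → s t + t * e ≤ s 0 + t * c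
telescope s         zero    _        = ≤-refl
telescope s {c} {e} (suc t) decrease = begin
  s (suc t) + (e + t * e)  ≡⟨ +-assoc (s (suc t)) e (t * e) ⟨
  s (suc t) + e + t * e    ≤⟨ +-monoˡ-≤ (t * e) (decrease t ≤-refl) ⟩
  c + s t + t * e          ≡⟨ +-assoc c (s t) (t * e) ⟩
  c + (s t + t * e)        ≤⟨ +-monoʳ-≤ c (telescope s t λ i i<t → decrease i (m≤n⇒m≤1+n i<t)) ⟩
  c + (s 0 + t * c)        ≡⟨ solve 3 (λ c a b → c :+ (a :+ b) := a :+ (c :+ b)) refl c (s 0) (t * c) ⟩
  s 0 + (c + t * c)        ∎
  where open ≤-Reasoning

-- With k = p + a and q ≤ p + 2a, the product p q is at most k² − a².
product<square : ∀ p a q → p + q ≤ (p + suc a) + (p + suc a) → p * q < (p + suc a) * (p + suc a)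
product<square p a q p+q≤2k = begin-strict
  p * q                          ≤⟨ *-monoʳ-≤ p q≤p+2a ⟩
  p * (p + (a′ + a′))            <⟨ m<m+n (p * (p + (a′ + a′))) 0<1+n ⟩
  p * (p + (a′ + a′)) + a′ * a′  ≡⟨ solve 2 (λ p a → p :* (p :+ (a :+ a)) :+ a :* a := (p :+ a) :* (p :+ a))
                                            refl p a′ ⟩
  (p + a′) * (p + a′)            ∎
  where
  open ≤-Reasoning
  a′ : ℕ
  a′ = suc a
  q≤p+2a : q ≤ p + (a′ + a′)
  q≤p+2a = +-cancelˡ-≤ p q _ (≤-trans p+q≤2k (≤-reflexive
    (solve 2 (λ p a → (p :+ a) :+ (p :+ a) := p :+ (p :+ (a :+ a))) refl p a′)))

am-gm-≤ : ∀ {k p q} → p ≤ k → p + q ≤ k + k → k * k ≤ p * q → p ≡ k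
am-gm-≤ {p = p} {q} p≤k p+q≤2k k²≤pq with m≤n⇒∃[o]m+o≡n p≤k
... | zero  , refl = sym (+-identityʳ p)
... | suc a , refl = contradiction k²≤pq (<⇒≱ (product<square p a q p+q≤2k))

am-gm : ∀ {k p q} → k * k ≤ p * q → k + k < p + q ⊎ (p ≡ k × q ≡ k)
am-gm {k} {p} {q} k²≤pq with p + q ≤? k + k
... | no  p+q≰2k = inj₁ (≰⇒> p+q≰2k)
... | yes p+q≤2k = inj₂ (first≡k p q p+q≤2k k²≤pq , first≡k q p (swap p q p+q≤2k) (swap′ p q k²≤pq))
  where
  swap : ∀ p q → p + q ≤ k + k → q + p ≤ k + k
  swap p q = subst (_≤ k + k) (+-comm p q)
  swap′ : ∀ p q → k * k ≤ p * q → k * k ≤ q * p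
  swap′ p q = subst (k * k ≤_) (*-comm p q)
  other≤ : ∀ p q → k ≤ p → p + q ≤ k + k → q ≤ k
  other≤ p q k≤p p+q≤2k = +-cancelˡ-≤ k q k (≤-trans (+-monoˡ-≤ q k≤p) p+q≤2k)
  first≡k : ∀ p q → p + q ≤ k + k → k * k ≤ p * q → p ≡ k
  first≡k p q p+q≤2k k²≤pq with p ≤? k
  ... | yes p≤k = am-gm-≤ p≤k p+q≤2k k²≤pq
  ... | no  p≰k = contradiction (other≤ q p (≤-reflexive (sym q≡k)) (swap p q p+q≤2k)) p≰k
    where
    q≡k : q ≡ k
    q≡k = am-gm-≤ (other≤ p q (<⇒≤ (≰⇒> p≰k)) p+q≤2k) (swap p q p+q≤2k) (swap′ p q k²≤pq)

time-trade-off : ∀ {k β t} → suc (k * k) + t ≤ suc t * β → k + k < β + t ⊎ (β ≡ suc k × suc t ≡ k)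
time-trade-off {k} {zero}  {t} bound = contradiction (≤-trans bound (≤-reflexive (*-zeroʳ (suc t)))) λ ()
time-trade-off {k} {suc p} {t} bound with am-gm {k} {p} {suc t} k²≤p[1+t]
  where
  k²≤p[1+t] : k * k ≤ p * suc t
  k²≤p[1+t] = +-cancelʳ-≤ (suc t) (k * k) (p * suc t) (begin
    k * k + suc t      ≡⟨ +-suc (k * k) t ⟩
    suc (k * k) + t    ≤⟨ bound ⟩
    suc t * suc p      ≡⟨ solve 2 (λ t p → (con 1 :+ t) :* (con 1 :+ p) := p :* (con 1 :+ t) :+ (con 1 :+ t))
                                refl t p ⟩
    p * suc t + suc t  ∎)
    where open ≤-Reasoning
... | inj₁ 2k<p+1+t       = inj₁ (subst (k + k <_) (+-suc p t) 2k<p+1+t)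
... | inj₂ (refl , 1+t≡k) = inj₂ (refl , 1+t≡k)

tight-case-impossible : ∀ {k β t} → β ≡ suc k → suc t ≡ k → ¬ (suc (k * k) + t + 1 ≤ suc t * β)
tight-case-impossible {t = t} refl refl bound = <-irrefl refl (begin-strict
  suc t * suc (suc t)          <⟨ n<1+n _ ⟩
  suc (suc t * suc (suc t))    ≡⟨ solve 1 (λ t → con 1 :+ (con 1 :+ t) :* (con 2 :+ t)
                                              := con 1 :+ (con 1 :+ t) :* (con 1 :+ t) :+ t :+ con 1) refl t ⟩
  suc (suc t * suc t) + t + 1  ≤⟨ bound ⟩
  suc t * suc (suc t)          ∎)
  where open ≤-Reasoning

quarter-loss : ∀ {j z a} → 4 * a ≤ 3 * z → 4 * j < z → suc j + a ≤ z
quarter-loss {j} {z} {a} 4a≤3z 4j<z with suc j + a ≤? z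
... | yes ok    = ok
... | no  j+a≥z = contradiction (begin
  z + 3 * z      ≡⟨ solve 1 (λ z → z :+ con 3 :* z := con 4 :* z) refl z ⟩
  4 * z          ≤⟨ *-monoʳ-≤ 4 (≤-pred (≰⇒> j+a≥z)) ⟩
  4 * (j + a)    ≡⟨ *-distribˡ-+ 4 j a ⟩
  4 * j + 4 * a  ≤⟨ +-monoʳ-≤ (4 * j) 4a≤3z ⟩
  4 * j + 3 * z  ∎) (<⇒≱ (+-monoˡ-< (3 * z) 4j<z))
  where open ≤-Reasoning

module _ {n} (G : SimpleGraph n) where

  Active : (Fin n → Set) → Fin n → Set
  Active S v = S v × (∀ u → Adj G v u → S u)

  active? : ∀ {S} → Decidable S → Decidable (Active S)
  active? S? v = S? v ×-dec all? λ u → (adj G v u Bool.≟ true) →-dec S? u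

  walk-leaves : ∀ {S} → Decidable S → ∀ {x y} → Walk G x y → S x → ¬ S y → ∃ λ v → S v × ¬ Active S v
  walk-leaves S? here                 sx ¬sy = contradiction sx ¬sy
  walk-leaves S? (there {v = z} a p) sx ¬sy with S? z
  ... | yes sz = walk-leaves S? p sz ¬sy
  ... | no ¬sz = _ , sx , λ (_ , nbrs) → ¬sz (nbrs z a)

  connected-loss : Connected G → ∀ {S} (S? : Decidable S) →
                   0 < count S? → count S? < n → count (active? S?) < count S?
  connected-loss connected S? 0<∣S∣ ∣S∣<n with count-witness S? 0<∣S∣ | all? S?
  ... | _ , _  | yes all = contradiction (count-all S? all) (<⇒≢ ∣S∣<n)
  ... | x , sx | no ¬all with ¬∀⟶∃¬ n _ S? ¬all
  ...   | y , ¬sy with walk-leaves S? (connected x y) sx ¬sy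
  ...     | v , sv , ¬active = count-mono-< (active? S?) S? proj₁ sv ¬active

  open DecMembership (≡-dec (Fin._≟_ {n}) (Fin._≟_ {n})) using () renaming (_∈?_ to _∈ₗ?_)

  blue? : ∀ B F t → Decidable (BlueBy G B F t)
  blue? B F zero    x = x ∈? B
  blue? B F (suc t) x = blue? B F t x ⊎-dec any? λ v → ((v , x) ∈ₗ? F) ×-dec active? (blue? B F t) v

  forcer-unused : ∀ {b u L v x} → Chron G b u L → (v , x) ∈ₗ L → v ∉ u
  forcer-unused (step (_ , v∉u , _) _) (here refl) = v∉u
  forcer-unused (step _ chron)         (there v→x) v∈u = forcer-unused chron v→x (x∈p∪q⁺ (inj₁ v∈u))

  forcer-unique : ∀ {b u L v x y} → Chron G b u L → (v , x) ∈ₗ L → (v , y) ∈ₗ L → x ≡ y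
  forcer-unique (step _ _)     (here refl) (here refl) = refl
  forcer-unique (step _ chron) (here refl) (there v→y) =
    contradiction (x∈p∪q⁺ (inj₂ (x∈⁅x⁆ _))) (forcer-unused chron v→y)
  forcer-unique (step _ chron) (there v→x) (here refl) =
    contradiction (x∈p∪q⁺ (inj₂ (x∈⁅x⁆ _))) (forcer-unused chron v→x)
  forcer-unique (step _ chron) (there v→x) (there v→y) = forcer-unique chron v→x v→y

  module Propagation (B : Subset n) (F : List (Force n)) where

    Blue : ℕ → Fin n → Set
    Blue = BlueBy G B F

    active-suc : ∀ {t v} → Active (Blue t) v → Active (Blue (suc t)) v
    active-suc (bv , nbrs) = inj₁ bv , λ u a → inj₁ (nbrs u a)

    blue-mono : ∀ {i j x} → i ≤ j → Blue i x → Blue j x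
    blue-mono {j = zero}  z≤n   bx = bx
    blue-mono {j = suc j} i≤1+j bx with m≤n⇒m<n∨m≡n i≤1+j
    ... | inj₁ (s≤s i≤j) = inj₁ (blue-mono i≤j bx)
    ... | inj₂ refl      = bx

    initial-or-forced : ∀ {t x} → Blue (suc t) x → x ∈ B ⊎ ∃ λ v → (v , x) ∈ₗ F × Active (Blue t) v
    initial-or-forced {zero}  (inj₁ x∈B) = inj₁ x∈B
    initial-or-forced {suc t} (inj₁ bx) with initial-or-forced bx
    ... | inj₁ x∈B             = inj₁ x∈B
    ... | inj₂ (v , v→x , act) = inj₂ (v , v→x , active-suc act)
    initial-or-forced         (inj₂ forced) = inj₂ forced

    blue≤initial+active : SetOfForces G B F → ∀ t →
                          count (blue? B F (suc t)) ≤ ∣ B ∣ + count (active? (blue? B F t))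
    blue≤initial+active forces t = begin
      count (blue? B F (suc t))           ≤⟨ count-⊆-∪ (blue? B F (suc t)) (_∈? B) forced? initial-or-forced ⟩
      count (_∈? B) + count forced?       ≡⟨ cong (_+ count forced?) (count-∈ B) ⟩
      ∣ B ∣ + count forced?               ≤⟨ +-monoʳ-≤ ∣ B ∣ (count≤-by-injection forced? (active? (blue? B F t))
                                               (λ v x → (v , x) ∈ₗ? F) id (forcer-unique forces)) ⟩
      ∣ B ∣ + count (active? (blue? B F t)) ∎
      where
      open ≤-Reasoning
      forced? : Decidable λ x → ∃ λ v → (v , x) ∈ₗ F × Active (Blue t) v
      forced? x = any? λ v → ((v , x) ∈ₗ? F) ×-dec active? (blue? B F t) v

-- A lower bound for graphs on k² + 1 vertices

module LowerBound {n k} (G : SimpleGraph n) (connected : Connected G) (n≡1+k² : n ≡ suc (k * k)) (2≤k : 2 ≤ k)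
  (loss₂ : ∀ {S} (S? : Decidable S) → count S? ≡ suc k → 2 + count (active? G S?) ≤ count S?)
  {B F} (forces : SetOfForces G B F) where

  open Propagation G B F

  β : ℕ
  β = ∣ B ∣

  s a : ℕ → ℕ
  s i = count (blue? G B F i)
  a i = count (active? G (blue? G B F i))

  s₀≡β : s 0 ≡ β
  s₀≡β = count-∈ B

  β≤s : ∀ i → β ≤ s i
  β≤s i = subst (_≤ s i) s₀≡β (count-mono (blue? G B F 0) (blue? G B F i) (blue-mono z≤n))

  round-bound : ∀ i → s (suc i) ≤ β + a i
  round-bound = blue≤initial+active forces

  round-growth : ∀ i → s (suc i) + 0 ≤ β + s i
  round-growth i = ≤-trans (≤-reflexive (+-identityʳ _))
    (≤-trans (round-bound i) (+-monoʳ-≤ β (count-mono (active? G (blue? G B F i)) (blue? G B F i) proj₁)))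

  round-loss : ∀ i → 0 < β → ¬ AllBlueBy G B F i → s (suc i) + 1 ≤ β + s i
  round-loss i 0<β ¬all with ¬∀⟶∃¬ _ _ (blue? G B F i) ¬all
  ... | _ , white = begin
    s (suc i) + 1    ≤⟨ +-monoˡ-≤ 1 (round-bound i) ⟩
    β + a i + 1      ≡⟨ +-assoc β (a i) 1 ⟩
    β + (a i + 1)    ≤⟨ +-monoʳ-≤ β (subst (_≤ s i) (+-comm 1 (a i)) a<s) ⟩
    β + s i          ∎
    where
    open ≤-Reasoning
    a<s : a i < s i
    a<s = connected-loss G connected (blue? G B F i) (≤-trans 0<β (β≤s i)) (count<n (blue? G B F i) white)

  first-round-loss₂ : β ≡ suc k → s 1 + 1 + 1 ≤ β + β
  first-round-loss₂ β≡1+k = begin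
    s 1 + 1 + 1      ≤⟨ +-monoˡ-≤ 1 (+-monoˡ-≤ 1 (round-bound 0)) ⟩
    β + a 0 + 1 + 1  ≡⟨ solve 2 (λ b a → b :+ a :+ con 1 :+ con 1 := b :+ (con 2 :+ a)) refl β (a 0) ⟩
    β + (2 + a 0)    ≤⟨ +-monoʳ-≤ β (≤-trans (loss₂ (blue? G B F 0) (trans s₀≡β β≡1+k)) (≤-reflexive s₀≡β)) ⟩
    β + β            ∎
    where open ≤-Reasoning

  module LastRound (t : ℕ) (all : AllBlueBy G B F (suc t)) (¬all : ¬ AllBlueBy G B F t) where

    s[1+t]≡n : s (suc t) ≡ suc (k * k)
    s[1+t]≡n = trans (count-all (blue? G B F (suc t)) all) n≡1+k²

    not-yet : ∀ {i} → i ≤ t → ¬ AllBlueBy G B F i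
    not-yet i≤t all-i = ¬all λ x → blue-mono i≤t (all-i x)

    -- With nothing blue initially, no round adds a blue vertex.
    0<β : 0 < β
    0<β = n≢0⇒n>0 λ β≡0 → contradiction (begin
      suc (k * k)              ≡⟨ trans (cong (s (suc t) +_) (*-zeroʳ (suc t))) (trans (+-identityʳ _) s[1+t]≡n) ⟨
      s (suc t) + suc t * 0    ≤⟨ telescope s (suc t) (λ i _ → round-growth i) ⟩
      s 0 + suc t * β          ≡⟨ cong₂ (λ s₀ β → s₀ + suc t * β) (trans s₀≡β β≡0) β≡0 ⟩
      suc t * 0                ≡⟨ *-zeroʳ (suc t) ⟩
      0                        ∎) λ ()
      where open ≤-Reasoning

    -- e counts vertices lost in the first round on top of the one lost in every round.
    rounds-bound : ∀ e → s 1 + 1 + e ≤ β + β → suc (k * k) + suc t + e ≤ suc (suc t) * β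
    rounds-bound e first = begin
      suc (k * k) + suc t + e      ≡⟨ cong (λ n → n + suc t + e) s[1+t]≡n ⟨
      s (suc t) + suc t + e        ≡⟨ solve 3 (λ s t e → s :+ (con 1 :+ t) :+ e := s :+ t :* con 1 :+ (con 1 :+ e))
                                              refl (s (suc t)) t e ⟩
      s (suc t) + t * 1 + (1 + e)  ≤⟨ +-monoˡ-≤ (1 + e) (telescope (s ∘ suc) t λ i i<t →
                                                            round-loss (suc i) 0<β (not-yet i<t)) ⟩
      s 1 + t * β + (1 + e)        ≡⟨ solve 3 (λ s b e → s :+ b :+ (con 1 :+ e) := s :+ con 1 :+ e :+ b)
                                              refl (s 1) (t * β) e ⟩
      s 1 + 1 + e + t * β          ≤⟨ +-monoˡ-≤ (t * β) first ⟩
      β + β + t * β                ≡⟨ solve 2 (λ b t → b :+ b :+ t :* b := (con 2 :+ t) :* b) refl β t ⟩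
      suc (suc t) * β              ∎
      where open ≤-Reasoning

    first-round-loss : s 1 + 1 + 0 ≤ β + β
    first-round-loss = ≤-trans (≤-reflexive (+-identityʳ _))
      (subst (λ s₀ → s 1 + 1 ≤ β + s₀) s₀≡β (round-loss 0 0<β (not-yet z≤n)))

    throttling≥ : suc (k + k) ≤ β + suc t
    throttling≥ with time-trade-off (≤-trans (≤-reflexive (sym (+-identityʳ _))) (rounds-bound 0 first-round-loss))
    ... | inj₁ 2k<β+1+t         = 2k<β+1+t
    ... | inj₂ (β≡1+k , 2+t≡k) =
      contradiction (rounds-bound 1 (first-round-loss₂ β≡1+k)) (tight-case-impossible β≡1+k 2+t≡k)

  throttling≥ : ∀ t → AllBlueBy G B F t → suc (k + k) ≤ ∣ B ∣ + t
  throttling≥ zero all = begin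
    suc (k + k)  ≤⟨ s≤s (≤-trans (≤-reflexive (solve 1 (λ k → k :+ k := con 2 :* k) refl k)) (*-monoˡ-≤ k 2≤k)) ⟩
    suc (k * k)  ≡⟨ trans (sym s₀≡β) (trans (count-all (blue? G B F 0) all) n≡1+k²) ⟨
    β            ≡⟨ +-identityʳ β ⟨
    β + 0        ∎
    where open ≤-Reasoning
  throttling≥ (suc t) all with all? (blue? G B F t)
  ... | yes all′ = ≤-trans (throttling≥ t all′) (+-monoʳ-≤ β (n≤1+n t))
  ... | no  ¬all = LastRound.throttling≥ t all ¬all

throttling-attained : ∀ {n} (G : SimpleGraph n) {th} →
  (∀ B F t → SetOfForces G B F → AllBlueBy G B F t → th ≤ ∣ B ∣ + t) →
  ∀ B F t → SetOfForces G B F → AllBlueBy G B F t → ∣ B ∣ + t ≡ th → IsHoppingThrottling G th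
throttling-attained G lower B F t forces all exact =
  (B , t , pt , exact) , λ B′ t′ ((F′ , forces′ , all′ , _) , _) → lower B′ F′ t′ forces′ all′
  where
  earlier-impossible : ∀ t′ → t′ < t → ¬ AllBlueBy G B F t′
  earlier-impossible t′ t′<t all′ =
    <⇒≱ (subst (∣ B ∣ + t′ <_) exact (+-monoʳ-< ∣ B ∣ t′<t)) (lower B F t′ forces all′)
  pt : IsPtB G B t
  pt = (F , forces , all , earlier-impossible)
     , λ F′ t′ forces′ (all′ , _) →
         +-cancelˡ-≤ ∣ B ∣ t t′ (subst (_≤ ∣ B ∣ + t′) (sym exact) (lower B F′ t′ forces′ all′))

-- Trees given by parent pointers

module ParentGraph {n} (parent : Fin n → Maybe (Fin n))
                   (parent< : ∀ {u v} → parent u ≡ just v → toℕ v < toℕ u) where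

  _↑_ : Fin n → Fin n → Set
  u ↑ v = parent u ≡ just v

  _↓_ : Fin n → Fin n → Set
  u ↓ v = v ↑ u

  _pointsTo_ : Maybe (Fin n) → Fin n → Bool
  nothing pointsTo v = false
  just p  pointsTo v = ⌊ p Fin.≟ v ⌋

  pointsTo⇒≡ : ∀ m {v} → T (m pointsTo v) → m ≡ just v
  pointsTo⇒≡ (just p) t = cong just (toWitness t)

  ↑⇒pointsTo : ∀ {u v} → u ↑ v → T (parent u pointsTo v)
  ↑⇒pointsTo u↑v rewrite u↑v = fromWitness refl

  ↑-irrefl : ∀ {u} → ¬ u ↑ u
  ↑-irrefl u↑u = <-irrefl refl (parent< u↑u)

  ↑-functional : ∀ {u v w} → u ↑ v → u ↑ w → v ≡ w
  ↑-functional u↑v u↑w = just-injective (trans (sym u↑v) u↑w)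

  graph : SimpleGraph n
  graph = record
    { adj    = λ u v → parent u pointsTo v ∨ parent v pointsTo u
    ; sym    = λ u v → ∨-comm (parent u pointsTo v) (parent v pointsTo u)
    ; irrefl = λ v → not-self (parent v pointsTo v) (↑-irrefl ∘ pointsTo⇒≡ (parent v))
    }
    where
    not-self : ∀ b → ¬ T b → b ∨ b ≡ false
    not-self false _  = refl
    not-self true  ¬t = contradiction tt ¬t

  adj⇒↑ : ∀ {u v} → Adj graph u v → u ↑ v ⊎ v ↑ u
  adj⇒↑ {u} {v} a with Equivalence.to T-∨ (Equivalence.from T-≡ a)
  ... | inj₁ t = inj₁ (pointsTo⇒≡ (parent u) t)
  ... | inj₂ t = inj₂ (pointsTo⇒≡ (parent v) t)

  ↑⇒adj : ∀ {u v} → u ↑ v → Adj graph u v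
  ↑⇒adj u↑v = Equivalence.to T-≡ (Equivalence.from T-∨ (inj₁ (↑⇒pointsTo u↑v)))

  ↓⇒adj : ∀ {u v} → v ↑ u → Adj graph u v
  ↓⇒adj v↑u = Equivalence.to T-≡ (Equivalence.from T-∨ (inj₂ (↑⇒pointsTo v↑u)))

  NoBacktrack : Fin n → Fin n → List (Fin n) → Set
  NoBacktrack a b []      = ⊤
  NoBacktrack a b (c ∷ l) = a ≢ c × NoBacktrack b c l

  FinalStep : (Fin n → Fin n → Set) → Fin n → Fin n → List (Fin n) → Set
  FinalStep R a b []      = R a b
  FinalStep R a b (c ∷ l) = FinalStep R b c l

  -- A walk without backtracking cannot step down to a child and then back up, since the only
  -- vertex above that child is where it came from.
  climbs-first-or-descends : ∀ y z ws → Chain graph (y ∷ z ∷ ws) → NoBacktrack y z ws →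
                             y ↑ z ⊎ Linked _↓_ (y ∷ z ∷ ws)
  climbs-first-or-descends y z ws (a , chain) nb with adj⇒↑ a
  ... | inj₁ y↑z = inj₁ y↑z
  climbs-first-or-descends y z []       _           _          | inj₂ z↑y = inj₂ (z↑y ∷ [-])
  climbs-first-or-descends y z (w ∷ ws) (_ , chain) (y≢w , nb) | inj₂ z↑y
    with climbs-first-or-descends z w ws chain nb
  ... | inj₁ z↑w  = contradiction (↑-functional z↑y z↑w) y≢w
  ... | inj₂ down = inj₂ (z↑y ∷ down)

  climbs-or-descends-last : ∀ y z ws → Chain graph (y ∷ z ∷ ws) → NoBacktrack y z ws →
                            Linked _↑_ (y ∷ z ∷ ws) ⊎ FinalStep _↓_ y z ws
  climbs-or-descends-last y z [] (a , _) _ with adj⇒↑ a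
  ... | inj₁ y↑z = inj₁ (y↑z ∷ [-])
  ... | inj₂ z↑y = inj₂ z↑y
  climbs-or-descends-last y z (w ∷ ws) (a , chain) (y≢w , nb) with climbs-or-descends-last z w ws chain nb
  ... | inj₂ final = inj₂ final
  ... | inj₁ up@(z↑w ∷ _) with adj⇒↑ a
  ...   | inj₁ y↑z = inj₁ (y↑z ∷ up)
  ...   | inj₂ z↑y = contradiction (↑-functional z↑y z↑w) y≢w

  final-step-from : ∀ {R} a b l w → FinalStep R a b (l ++ w ∷ []) → Any (λ v → R v w) (b ∷ l)
  final-step-from a b []      w r = here r
  final-step-from a b (c ∷ l) w f = there (final-step-from b c l w f)

  no-backtrack : ∀ {a b} l → AllPairs _≢_ (a ∷ b ∷ l) → NoBacktrack a b l
  no-backtrack []      _                          = tt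
  no-backtrack (c ∷ l) ((_ ∷ a≢c ∷ _) ∷ distinct) = a≢c , no-backtrack l distinct

  no-monotone-loop : ∀ {R : Fin n → Fin n → Set} → (∀ {a b c} → R a b → R b c → R a c) → (∀ {a} → ¬ R a a) →
                     ∀ x xs → ¬ Linked R (x ∷ xs ++ x ∷ [])
  no-monotone-loop R-trans R-irrefl x []       (r ∷ [-]) = R-irrefl r
  no-monotone-loop R-trans R-irrefl x (y ∷ ys) (r ∷ rs) with ++⁻ʳ (y ∷ ys) (Linked⇒All R-trans r rs)
  ... | r′ ∷ [] = R-irrefl r′

  acyclic : ¬ HasCycle graph
  acyclic (x , []              , () , _)
  acyclic (x , _ ∷ []          , s≤s () , _)
  acyclic (x , x₁ ∷ x₂ ∷ rest , _ , (x≢ ∷ x₁≢ ∷ distinct) , chain)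
    with climbs-first-or-descends x x₁ walk chain nb | climbs-or-descends-last x x₁ walk chain nb
    where
    walk : List (Fin n)
    walk = x₂ ∷ rest ++ x ∷ []
    nb : NoBacktrack x x₁ walk
    nb = All.lookup x≢ (there (here refl))
       , no-backtrack (rest ++ x ∷ [])
           (AllPairs.++⁺ (x₁≢ ∷ distinct) ([] ∷ []) (All.map (λ x≢y → (λ y≡x → x≢y (sym y≡x)) ∷ []) x≢))
  ... | inj₂ down | _          =
    no-monotone-loop <-trans (<-irrefl refl) x (x₁ ∷ x₂ ∷ rest) (Linked.map parent< down)
  ... | inj₁ _    | inj₁ up    =
    no-monotone-loop (flip <-trans) (<-irrefl refl) x (x₁ ∷ x₂ ∷ rest) (Linked.map parent< up)
  ... | inj₁ x↑x₁ | inj₂ final =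
    All¬⇒¬Any (All.map (λ x₁≢v x↑v → x₁≢v (↑-functional x↑x₁ x↑v)) x₁≢) (final-step-from x₁ x₂ rest x final)

  _++ʷ_ : ∀ {u v w} → Walk graph u v → Walk graph v w → Walk graph u w
  here      ++ʷ q = q
  there a p ++ʷ q = there a (p ++ʷ q)

  reverseʷ : ∀ {u v} → Walk graph u v → Walk graph v u
  reverseʷ here                = here
  reverseʷ (there {u} {v} a p) = reverseʷ p ++ʷ there (trans (SimpleGraph.sym graph v u) a) here

  module _ (root : Fin n) (only-root : ∀ u → parent u ≡ nothing → u ≡ root) where

    walk-to-root : ∀ m u → toℕ u < m → Walk graph u root
    walk-to-root (suc m) u (s≤s u<1+m) with parent u in eq
    ... | nothing = subst (λ w → Walk graph w root) (sym (only-root u eq)) here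
    ... | just v  = there (↑⇒adj eq) (walk-to-root m v (≤-trans (parent< eq) u<1+m))

    connected : Connected graph
    connected u v = walk-to-root n u (toℕ<n u) ++ʷ reverseʷ (walk-to-root n v (toℕ<n v))

    isTree : IsTree graph
    isTree = ≤-trans (s≤s z≤n) (toℕ<n root) , connected , acyclic

-- Spiders

-- d legs of k + 1 vertices each; foot ℓ r is the vertex of leg ℓ at distance r + 1 from the centre.
module Spider (d k : ℕ) where

  n : ℕ
  n = suc (d * suc k)

  centre : Fin n
  centre = zero

  foot : Fin d → Fin (suc k) → Fin n
  foot ℓ r = suc (combine ℓ r)

  data View : Fin n → Set where
    is-centre : View centre
    is-foot   : ∀ ℓ r → View (foot ℓ r)

  view : ∀ v → View v
  view zero    = is-centre
  view (suc x) = subst (View ∘ suc) (combine-remQuot {d} (suc k) x) (uncurry is-foot (remQuot {d} (suc k) x))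

  towardsCentre : Fin d → Fin (suc k) → Fin n
  towardsCentre ℓ zero    = centre
  towardsCentre ℓ (suc r) = foot ℓ (inject₁ r)

  parent : Fin n → Maybe (Fin n)
  parent zero    = nothing
  parent (suc x) = just (uncurry towardsCentre (remQuot (suc k) x))

  parent-foot : ∀ ℓ r → parent (foot ℓ r) ≡ just (towardsCentre ℓ r)
  parent-foot ℓ r = cong (just ∘ uncurry towardsCentre) (remQuot-combine ℓ r)

  toℕ-foot : ∀ ℓ r → toℕ (foot ℓ r) ≡ suc (suc k * toℕ ℓ + toℕ r)
  toℕ-foot ℓ r = cong suc (toℕ-combine ℓ r)

  toℕ-foot-suc : ∀ ℓ r → toℕ (foot ℓ (suc r)) ≡ suc (toℕ (foot ℓ (inject₁ r)))
  toℕ-foot-suc ℓ r = begin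
    toℕ (foot ℓ (suc r))                         ≡⟨ toℕ-foot ℓ (suc r) ⟩
    suc (suc k * toℕ ℓ + suc (toℕ r))            ≡⟨ cong suc (+-suc (suc k * toℕ ℓ) (toℕ r)) ⟩
    suc (suc (suc k * toℕ ℓ + toℕ r))            ≡⟨ cong (λ i → suc (suc (suc k * toℕ ℓ + i))) (toℕ-inject₁ r) ⟨
    suc (suc (suc k * toℕ ℓ + toℕ (inject₁ r)))  ≡⟨ cong suc (toℕ-foot ℓ (inject₁ r)) ⟨
    suc (toℕ (foot ℓ (inject₁ r)))               ∎
    where open ≡-Reasoning

  parent< : ∀ {u v} → parent u ≡ just v → toℕ v < toℕ u
  parent< {u} eq with view u
  parent< ()  | is-centre
  parent< eq  | is-foot ℓ r with trans (sym (parent-foot ℓ r)) eq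
  parent< _   | is-foot ℓ zero    | refl = s≤s z≤n
  parent< _   | is-foot ℓ (suc r) | refl = ≤-reflexive (sym (toℕ-foot-suc ℓ r))

  open ParentGraph parent parent< public using (_↑_; ↑⇒adj; ↓⇒adj; adj⇒↑) renaming (graph to spider)

  only-centre-is-root : ∀ u → parent u ≡ nothing → u ≡ centre
  only-centre-is-root zero    _  = refl
  only-centre-is-root (suc x) ()

  spider-connected : Connected spider
  spider-connected = ParentGraph.connected parent parent< centre only-centre-is-root

  spider-isTree : IsTree spider
  spider-isTree = ParentGraph.isTree parent parent< centre only-centre-is-root

  child-of-foot : ∀ {u ℓ r} → u ↑ foot ℓ r → ∃ λ r′ → u ≡ foot ℓ (suc r′) × inject₁ r′ ≡ r
  child-of-foot {u} u↑foot with view u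
  ... | is-centre = case u↑foot of λ ()
  ... | is-foot ℓ′ r′ with just-injective (trans (sym (parent-foot ℓ′ r′)) u↑foot)
  ...   | eq with r′
  ...     | zero   = case eq of λ ()
  ...     | suc r″ with Finₚ.suc-injective eq
  ...       | eq′ with combine-injectiveˡ ℓ′ (inject₁ r″) _ _ eq′ | combine-injectiveʳ ℓ′ (inject₁ r″) _ _ eq′
  ...         | refl | refl = r″ , refl , refl

  foot-neighbours : ∀ {ℓ r u} → Adj spider (foot ℓ r) u → u ≡ centre ⊎ ∃ λ r′ → u ≡ foot ℓ r′
  foot-neighbours {ℓ} {r} a with adj⇒↑ a
  ... | inj₂ u↑foot with child-of-foot u↑foot
  ...   | r′ , u≡foot , _ = inj₂ (suc r′ , u≡foot)
  foot-neighbours {ℓ} {zero}  a | inj₁ foot↑u with trans (sym (parent-foot ℓ zero)) foot↑u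
  ... | refl = inj₁ refl
  foot-neighbours {ℓ} {suc r} a | inj₁ foot↑u with trans (sym (parent-foot ℓ (suc r))) foot↑u
  ... | refl = inj₂ (inject₁ r , refl)

  foot-neighbour-index : ∀ {ℓ r u} → Adj spider (foot ℓ r) u → toℕ u ≤ suc (toℕ (foot ℓ r))
  foot-neighbour-index a with adj⇒↑ a
  ... | inj₁ foot↑u = m≤n⇒m≤1+n (<⇒≤ (parent< foot↑u))
  ... | inj₂ u↑foot with child-of-foot u↑foot
  ...   | r′ , refl , refl = ≤-reflexive (toℕ-foot-suc _ r′)

  head-adj-centre : ∀ ℓ → Adj spider (foot ℓ zero) centre
  head-adj-centre ℓ = ↑⇒adj (parent-foot ℓ zero)

  centre-adj-head : ∀ ℓ → Adj spider centre (foot ℓ zero)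
  centre-adj-head ℓ = ↓⇒adj (parent-foot ℓ zero)

  foot-adj-next : ∀ ℓ r → Adj spider (foot ℓ (inject₁ r)) (foot ℓ (suc r))
  foot-adj-next ℓ r = ↓⇒adj (parent-foot ℓ (suc r))

  foot-adj-prev : ∀ ℓ r → Adj spider (foot ℓ (suc r)) (foot ℓ (inject₁ r))
  foot-adj-prev ℓ r = ↑⇒adj (parent-foot ℓ (suc r))

-- The colours along a leg, position 0 being next to the centre.  activeAt c s r: position r is
-- blue with all neighbours blue, the centre having colour c.
Profile : Set
Profile = Fin 4 → Bool

activeAt : Bool → Profile → Fin 4 → Bool
activeAt c s 0F = s 0F ∧ c ∧ s 1F
activeAt c s 1F = s 1F ∧ s 0F ∧ s 2F
activeAt c s 2F = s 2F ∧ s 1F ∧ s 3F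
activeAt c s 3F = s 3F ∧ s 2F

legBlue : Profile → ℕ
legBlue s = sum (⟨_⟩ ∘ s)

legActive : Bool → Profile → ℕ
legActive c s = sum (⟨_⟩ ∘ activeAt c s)

profile : Bool → Bool → Bool → Bool → Profile
profile s₀ s₁ s₂ s₃ 0F = s₀
profile s₀ s₁ s₂ s₃ 1F = s₁
profile s₀ s₁ s₂ s₃ 2F = s₂
profile s₀ s₁ s₂ s₃ 3F = s₃

∀-Bool? : ∀ {p} {P : Bool → Set p} → (∀ b → Dec (P b)) → Dec (∀ b → P b)
∀-Bool? P? = map′ (λ (f , t) → λ { false → f ; true → t }) (λ all → all false , all true) (P? false ×-dec P? true)

∀-profile? : ∀ {p} {P : Profile → Set p} → (∀ s → Dec (P s)) → Dec (∀ s₀ s₁ s₂ s₃ → P (profile s₀ s₁ s₂ s₃))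
∀-profile? P? = ∀-Bool? λ s₀ → ∀-Bool? λ s₁ → ∀-Bool? λ s₂ → ∀-Bool? λ s₃ → P? (profile s₀ s₁ s₂ s₃)

-- Checked by evaluation on all sixteen profiles; an arbitrary s is definitionally replaced by
-- profile (s 0F) (s 1F) (s 2F) (s 3F) because the statements only inspect s at 0F, …, 3F.
legActive≤legBlue : ∀ c s → legActive c s ≤ legBlue s
legActive≤legBlue c s =
  from-yes (∀-Bool? λ c → ∀-profile? λ s → legActive c s ≤? legBlue s) c (s 0F) (s 1F) (s 2F) (s 3F)

leg-loss-white-centre : ∀ s → 4 * legActive false s ≤ 3 * legBlue s
leg-loss-white-centre s =
  from-yes (∀-profile? λ s → 4 * legActive false s ≤? 3 * legBlue s) (s 0F) (s 1F) (s 2F) (s 3F)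

leg-loss-blue-centre : ∀ s → legActive true s < legBlue s ⊎ 4 ∣ legBlue s
leg-loss-blue-centre s =
  from-yes (∀-profile? λ s → legActive true s <? legBlue s ⊎-dec 4 ∣? legBlue s) (s 0F) (s 1F) (s 2F) (s 3F)

T-does : ∀ {p} {P : Set p} (P? : Dec P) → P → T (does P?)
T-does (yes _) _ = _
T-does (no ¬p) p = contradiction p ¬p

T-∧-intro : ∀ {a b} → T a → T b → T (a ∧ b)
T-∧-intro ta tb = Equivalence.from T-∧ (ta , tb)

module SpiderLosses (d : ℕ) where
  open Spider d 3

  module _ {S : Fin n → Set} (S? : Decidable S) where

    leg : Fin d → Profile
    leg ℓ r = does (S? (foot ℓ r))

    blueOnLegs : ℕ
    blueOnLegs = sum (λ ℓ → legBlue (leg ℓ))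

    activeOnLegs : Bool → ℕ
    activeOnLegs c = sum (λ ℓ → legActive c (leg ℓ))

    count-centre+legs : ∀ {P : Fin n → Set} (P? : Decidable P) →
                        count P? ≡ ⟦ P? centre ⟧ + sum (λ ℓ → sum (λ r → ⟦ P? (foot ℓ r) ⟧))
    count-centre+legs P? = cong (⟦ P? centre ⟧ +_) (sum-combine d (λ x → ⟦ P? (suc x) ⟧))

    blue-count-at : ∀ {c} → does (S? centre) ≡ c → count S? ≡ ⟨ c ⟩ + blueOnLegs
    blue-count-at refl = count-centre+legs S?

    blue⇒T : ∀ {v} → S v → T (does (S? v))
    blue⇒T = T-does (S? _)

    active-foot : ∀ ℓ r → Active spider S (foot ℓ r) → T (activeAt (does (S? centre)) (leg ℓ) r)
    active-foot ℓ 0F (s , nbrs) =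
      T-∧-intro (blue⇒T s) (T-∧-intro (blue⇒T (nbrs _ (head-adj-centre ℓ))) (blue⇒T (nbrs _ (foot-adj-next ℓ 0F))))
    active-foot ℓ 1F (s , nbrs) =
      T-∧-intro (blue⇒T s) (T-∧-intro (blue⇒T (nbrs _ (foot-adj-prev ℓ 0F))) (blue⇒T (nbrs _ (foot-adj-next ℓ 1F))))
    active-foot ℓ 2F (s , nbrs) =
      T-∧-intro (blue⇒T s) (T-∧-intro (blue⇒T (nbrs _ (foot-adj-prev ℓ 1F))) (blue⇒T (nbrs _ (foot-adj-next ℓ 2F))))
    active-foot ℓ 3F (s , nbrs) = T-∧-intro (blue⇒T s) (blue⇒T (nbrs _ (foot-adj-prev ℓ 2F)))

    active-count-at : ∀ {a c} → does (active? spider S? centre) ≡ a → does (S? centre) ≡ c →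
                      count (active? spider S?) ≤ ⟨ a ⟩ + activeOnLegs c
    active-count-at refl refl = ≤-trans (≤-reflexive (count-centre+legs (active? spider S?)))
      (+-monoʳ-≤ _ (sum-mono λ ℓ → sum-mono λ r → ⟦⟧-mono (active? spider S? (foot ℓ r)) (T? _) (active-foot ℓ r)))

    white-centre-quarter-loss : 4 * activeOnLegs false ≤ 3 * blueOnLegs
    white-centre-quarter-loss = begin
      4 * activeOnLegs false                   ≡⟨ *-distribˡ-sum 4 (λ ℓ → legActive false (leg ℓ)) ⟩
      sum (λ ℓ → 4 * legActive false (leg ℓ))  ≤⟨ sum-mono (leg-loss-white-centre ∘ leg) ⟩
      sum (λ ℓ → 3 * legBlue (leg ℓ))          ≡⟨ *-distribˡ-sum 3 (λ ℓ → legBlue (leg ℓ)) ⟨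
      3 * blueOnLegs                           ∎
      where open ≤-Reasoning

    heads-blue : Active spider S centre → ∀ ℓ → T (leg ℓ 0F)
    heads-blue (_ , nbrs) ℓ = blue⇒T (nbrs _ (centre-adj-head ℓ))

    module _ {K} (∣S∣≡1+K : count S? ≡ suc K) where

      centre-not-active : K < d → ¬ Active spider S centre
      centre-not-active K<d a₀ = <⇒≱ K<d (≤-pred (begin-strict
        d                    ≡⟨ trans (sum-const d (λ _ → 1) (λ _ → refl)) (*-identityʳ d) ⟨
        sum {d} (λ _ → 1)    ≤⟨ sum-mono head≤leg ⟩
        blueOnLegs           <⟨ n<1+n _ ⟩
        1 + blueOnLegs       ≡⟨ trans (sym (blue-count-at (dec-true (S? centre) (proj₁ a₀)))) ∣S∣≡1+K ⟩
        suc K                ∎))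
        where
        open ≤-Reasoning
        head≤leg : ∀ ℓ → 1 ≤ legBlue (leg ℓ)
        head≤leg ℓ = ≤-trans (≤-reflexive (sym (⟨⟩-T (heads-blue a₀ ℓ)))) (term≤sum (⟨_⟩ ∘ leg ℓ) 0F)

      two-losses-blue-centre : ¬ 4 ∣ K → S centre → ¬ Active spider S centre →
                               2 + count (active? spider S?) ≤ count S?
      two-losses-blue-centre 4∤K s₀ ¬a₀ with sum-<-or-all _ _ (legActive≤legBlue true ∘ leg) (leg-loss-blue-centre ∘ leg)
      ... | inj₁ A<Z = begin
        2 + count (active? spider S?)  ≤⟨ +-monoʳ-≤ 2 (active-count-at (dec-false (active? spider S? centre) ¬a₀)
                                                                        (dec-true (S? centre) s₀)) ⟩
        2 + (0 + activeOnLegs true)    ≤⟨ s≤s A<Z ⟩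
        1 + blueOnLegs                 ≡⟨ blue-count-at (dec-true (S? centre) s₀) ⟨
        count S?                       ∎
        where open ≤-Reasoning
      ... | inj₂ 4∣legs = contradiction (subst (4 ∣_) legs≡K (sum-∣ _ 4∣legs)) 4∤K
        where
        legs≡K : blueOnLegs ≡ K
        legs≡K = suc-injective (trans (sym (blue-count-at (dec-true (S? centre) s₀))) ∣S∣≡1+K)

      two-losses-white-centre : 4 ≤ K → ¬ S centre → 2 + count (active? spider S?) ≤ count S?
      two-losses-white-centre 4≤K ¬s₀ = begin
        2 + count (active? spider S?)  ≤⟨ +-monoʳ-≤ 2 (active-count-at (dec-false (active? spider S? centre) (¬s₀ ∘ proj₁))
                                                                        (dec-false (S? centre) ¬s₀)) ⟩
        2 + (0 + activeOnLegs false)   ≤⟨ quarter-loss {1} white-centre-quarter-loss (subst (4 <_) (sym legs≡1+K) (s≤s 4≤K)) ⟩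
        blueOnLegs                     ≡⟨ blue-count-at (dec-false (S? centre) ¬s₀) ⟨
        count S?                       ∎
        where
        open ≤-Reasoning
        legs≡1+K : blueOnLegs ≡ suc K
        legs≡1+K = trans (sym (blue-count-at (dec-false (S? centre) ¬s₀))) ∣S∣≡1+K

    spider-loss₂ : ∀ {K} → 4 ≤ K → K < d → ¬ 4 ∣ K → count S? ≡ suc K → 2 + count (active? spider S?) ≤ count S?
    spider-loss₂ 4≤K K<d 4∤K ∣S∣≡1+K = by-centre (S? centre)
      where
      by-centre : Dec (S centre) → 2 + count (active? spider S?) ≤ count S?
      by-centre (yes s₀) = two-losses-blue-centre ∣S∣≡1+K 4∤K s₀ (centre-not-active ∣S∣≡1+K K<d)
      by-centre (no ¬s₀) = two-losses-white-centre ∣S∣≡1+K 4≤K ¬s₀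

-- An explicit forcing schedule

below : ∀ {n} → ℕ → Subset n
below {zero}  _       = []
below {suc n} zero    = outside ∷ below zero
below {suc n} (suc j) = inside ∷ below j

below⁺ : ∀ {n j} {x : Fin n} → toℕ x < j → x ∈ below j
below⁺ {j = suc j} {zero}  _        = Vec.here
below⁺ {j = suc j} {suc x} (s≤s lt) = Vec.there (below⁺ lt)

below⁻ : ∀ {n j} {x : Fin n} → x ∈ below j → toℕ x < j
below⁻ {j = suc j} {zero}  Vec.here      = s≤s z≤n
below⁻ {j = zero}  {suc x} (Vec.there p) = contradiction (below⁻ p) λ ()
below⁻ {j = suc j} {suc x} (Vec.there p) = s≤s (below⁻ p)

∣below∣ : ∀ {n j} → j ≤ n → ∣ below {n} j ∣ ≡ j
∣below∣ {zero}          z≤n       = refl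
∣below∣ {suc n} {zero}  _         = ∣below∣ {n} z≤n
∣below∣ {suc n} {suc j} (s≤s j≤n) = cong suc (∣below∣ j≤n)

module ShiftSchedule {N} (G : SimpleGraph (suc N)) (s : ℕ) (0<s : 0 < s)
  (local : ∀ {x y} → 0 < toℕ x → Adj G x y → toℕ y < toℕ x + s) where

  -- Junk value 0 when i > N; it is only ever used with i ≤ N.
  vertex : ℕ → Fin (suc N)
  vertex i with i <? suc N
  ... | yes i<n = fromℕ< i<n
  ... | no  _   = zero

  toℕ-vertex : ∀ {i} → i < suc N → toℕ (vertex i) ≡ i
  toℕ-vertex {i} i<n with i <? suc N
  ... | yes _   = toℕ-fromℕ< _
  ... | no  i≮n = contradiction i<n i≮n

  vertex-toℕ : ∀ x → vertex (toℕ x) ≡ x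
  vertex-toℕ x = toℕ-injective (toℕ-vertex (toℕ<n x))

  shiftForces : ℕ → ℕ → List (Force (suc N))
  shiftForces j zero    = []
  shiftForces j (suc c) = (vertex j , vertex (j + s)) ∷ shiftForces (suc j) c

  shiftForces-∋ : ∀ c j i → j ≤ i → i < j + c → (vertex i , vertex (i + s)) ∈ₗ shiftForces j c
  shiftForces-∋ zero    j i j≤i i<j+0 = contradiction (subst (i <_) (+-identityʳ j) i<j+0) (≤⇒≯ j≤i)
  shiftForces-∋ (suc c) j i j≤i i<j+c with m≤n⇒m<n∨m≡n j≤i
  ... | inj₂ refl = here refl
  ... | inj₁ j<i  = there (shiftForces-∋ c (suc j) i j<i (subst (i <_) (+-suc j c) i<j+c))

  shift-chronology : ∀ c j {b u} → j + c + s ≡ suc N → 0 < j →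
    (∀ {x} → toℕ x < j + s → x ∈ b) → (∀ {x} → x ∈ b → toℕ x < j + s) → (∀ {x} → x ∈ u → toℕ x < j) →
    Chron G b u (shiftForces j c)
  shift-chronology zero j {b} total 0<j b⊇ b⊆ u⊆ = done λ v w (_ , _ , w∉b , _) →
    w∉b (b⊇ (subst (toℕ w <_) (sym (trans (cong (_+ s) (sym (+-identityʳ j))) total)) (toℕ<n w)))
  shift-chronology (suc c) j {b} {u} total 0<j b⊇ b⊆ u⊆ =
    step (v∈b , v∉u , w∉b , nbrs-blue) (shift-chronology c (suc j) total′ (s≤s z≤n) b⊇′ b⊆′ u⊆′)
    where
    j+s<n : j + s < suc N
    j+s<n = subst (j + s <_) total (+-monoˡ-< s (m<m+n j (s≤s z≤n)))
    v w : Fin (suc N)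
    v = vertex j
    w = vertex (j + s)
    toℕ-v : toℕ v ≡ j
    toℕ-v = toℕ-vertex (≤-<-trans (m≤m+n j s) j+s<n)
    toℕ-w : toℕ w ≡ j + s
    toℕ-w = toℕ-vertex j+s<n
    v∈b : v ∈ b
    v∈b = b⊇ (subst (_< j + s) (sym toℕ-v) (m<m+n j 0<s))
    v∉u : v ∉ u
    v∉u v∈u = <-irrefl toℕ-v (u⊆ v∈u)
    w∉b : w ∉ b
    w∉b w∈b = <-irrefl toℕ-w (b⊆ w∈b)
    nbrs-blue : ∀ y → Adj G v y → y ∈ b
    nbrs-blue y a = b⊇ (subst (λ i → toℕ y < i + s) toℕ-v (local (subst (0 <_) (sym toℕ-v) 0<j) a))
    total′ : suc j + c + s ≡ suc N
    total′ = trans (cong (_+ s) (sym (+-suc j c))) total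
    b⊇′ : ∀ {x} → toℕ x < suc j + s → x ∈ b ∪ ⁅ w ⁆
    b⊇′ {x} x<1+j+s with m≤n⇒m<n∨m≡n (≤-pred x<1+j+s)
    ... | inj₁ x<j+s = x∈p∪q⁺ (inj₁ (b⊇ x<j+s))
    ... | inj₂ x≡j+s = x∈p∪q⁺ (inj₂ (subst (_∈ ⁅ w ⁆) (toℕ-injective (trans toℕ-w (sym x≡j+s))) (x∈⁅x⁆ w)))
    b⊆′ : ∀ {x} → x ∈ b ∪ ⁅ w ⁆ → toℕ x < suc j + s
    b⊆′ {x} x∈ with x∈p∪q⁻ b ⁅ w ⁆ x∈
    ... | inj₁ x∈b = m<n⇒m<1+n (b⊆ x∈b)
    ... | inj₂ x∈w = s≤s (≤-reflexive (trans (cong toℕ (x∈⁅y⁆⇒x≡y w x∈w)) toℕ-w))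
    u⊆′ : ∀ {x} → x ∈ u ∪ ⁅ v ⁆ → toℕ x < suc j
    u⊆′ {x} x∈ with x∈p∪q⁻ u ⁅ v ⁆ x∈
    ... | inj₁ x∈u = m<n⇒m<1+n (u⊆ x∈u)
    ... | inj₂ x∈v = s≤s (≤-reflexive (trans (cong toℕ (x∈⁅y⁆⇒x≡y v x∈v)) toℕ-v))

-- The centre and legs 0, …, w − 1 start blue; then foot ℓ r forces foot (ℓ + w) r.
module SpiderSchedule (d w : ℕ) (0<w : 0 < w) (w≤d : w ≤ d) where
  open Spider d 3

  shift : ℕ
  shift = w * 4

  4≤shift : 4 ≤ shift
  4≤shift = *-monoˡ-≤ 4 0<w

  local : ∀ {x y} → 0 < toℕ x → Adj spider x y → toℕ y < toℕ x + shift
  local {x} 0<x a with view x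
  ... | is-foot ℓ r = ≤-trans (s≤s (foot-neighbour-index a))
                        (subst (_≤ toℕ (foot ℓ r) + shift) (+-comm (toℕ (foot ℓ r)) 2)
                               (+-monoʳ-≤ (toℕ (foot ℓ r)) (≤-trans (s≤s (s≤s z≤n)) 4≤shift)))

  open ShiftSchedule spider shift (≤-trans (s≤s z≤n) 4≤shift) local

  initial : Subset n
  initial = below (suc shift)

  forces : List (Force n)
  forces = shiftForces 1 (d * 4 ∸ shift)

  shift≤ : shift ≤ d * 4
  shift≤ = *-monoˡ-≤ 4 w≤d

  ∣initial∣ : ∣ initial ∣ ≡ suc shift
  ∣initial∣ = ∣below∣ (s≤s shift≤)

  chronology : SetOfForces spider initial forces
  chronology = shift-chronology (d * 4 ∸ shift) 1 (cong suc (m∸n+n≡m shift≤)) (s≤s z≤n)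
                                below⁺ below⁻ (λ x∈∅ → contradiction x∈∅ ∉⊥)

  centre-blue : ∀ t → BlueBy spider initial forces t centre
  centre-blue zero    = below⁺ (s≤s z≤n)
  centre-blue (suc t) = inj₁ (centre-blue t)

  toℕ-foot-shift : ∀ {ℓ′ ℓ} r → toℕ ℓ ≡ toℕ ℓ′ + w → toℕ (foot ℓ r) ≡ toℕ (foot ℓ′ r) + shift
  toℕ-foot-shift {ℓ′} {ℓ} r ℓ≡ℓ′+w = begin
    toℕ (foot ℓ r)                           ≡⟨ toℕ-foot ℓ r ⟩
    suc (4 * toℕ ℓ + toℕ r)                  ≡⟨ cong (λ i → suc (4 * i + toℕ r)) ℓ≡ℓ′+w ⟩
    suc (4 * (toℕ ℓ′ + w) + toℕ r)           ≡⟨ solve 3 (λ l w r → con 1 :+ (con 4 :* (l :+ w) :+ r)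
                                                             := con 1 :+ (con 4 :* l :+ r) :+ w :* con 4)
                                                  refl (toℕ ℓ′) w (toℕ r) ⟩
    suc (4 * toℕ ℓ′ + toℕ r) + shift         ≡⟨ cong (_+ shift) (toℕ-foot ℓ′ r) ⟨
    toℕ (foot ℓ′ r) + shift                  ∎
    where open ≡-Reasoning

  forced-by-earlier-leg : ∀ {ℓ′ ℓ} r → toℕ ℓ ≡ toℕ ℓ′ + w → (foot ℓ′ r , foot ℓ r) ∈ₗ forces
  forced-by-earlier-leg {ℓ′} {ℓ} r ℓ≡ℓ′+w =
    subst₂ (λ v x → (v , x) ∈ₗ forces)
           (vertex-toℕ (foot ℓ′ r)) (trans (cong vertex (sym index≡)) (vertex-toℕ (foot ℓ r)))
           (shiftForces-∋ (d * 4 ∸ shift) 1 (toℕ (foot ℓ′ r)) (s≤s z≤n) index<)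
    where
    index≡ : toℕ (foot ℓ r) ≡ toℕ (foot ℓ′ r) + shift
    index≡ = toℕ-foot-shift r ℓ≡ℓ′+w
    index< : toℕ (foot ℓ′ r) < suc (d * 4 ∸ shift)
    index< = +-cancelʳ-< shift _ _ (begin-strict
      toℕ (foot ℓ′ r) + shift      ≡⟨ index≡ ⟨
      toℕ (foot ℓ r)               <⟨ toℕ<n (foot ℓ r) ⟩
      suc (d * 4)                  ≡⟨ cong suc (m∸n+n≡m shift≤) ⟨
      suc (d * 4 ∸ shift + shift)  ∎)
      where open ≤-Reasoning

  blue-legs : ∀ t ℓ r → toℕ ℓ < suc t * w → BlueBy spider initial forces t (foot ℓ r)
  blue-legs zero ℓ r ℓ<w+0 = below⁺ (s≤s (begin
    toℕ (foot ℓ r)               ≡⟨ toℕ-foot ℓ r ⟩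
    suc (4 * toℕ ℓ + toℕ r)      ≤⟨ +-monoʳ-< (4 * toℕ ℓ) (toℕ<n r) ⟩
    4 * toℕ ℓ + 4                ≡⟨ trans (*-suc 4 (toℕ ℓ)) (+-comm 4 _) ⟨
    4 * suc (toℕ ℓ)              ≤⟨ *-monoʳ-≤ 4 (subst (toℕ ℓ <_) (+-identityʳ w) ℓ<w+0) ⟩
    4 * w                        ≡⟨ *-comm 4 w ⟩
    shift                        ∎))
    where open ≤-Reasoning
  blue-legs (suc t) ℓ r ℓ<bound with toℕ ℓ <? suc t * w
  ... | yes earlier = inj₁ (blue-legs t ℓ r earlier)
  ... | no  later   = inj₂ (foot ℓ′ r , forced-by-earlier-leg r ℓ≡ℓ′+w , blue-legs t ℓ′ r ℓ′<bound , nbrs-blue)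
    where
    ℓ′ : Fin d
    ℓ′ = fromℕ< (≤-<-trans (m∸n≤m (toℕ ℓ) w) (toℕ<n ℓ))
    ℓ≡ℓ′+w : toℕ ℓ ≡ toℕ ℓ′ + w
    ℓ≡ℓ′+w = sym (trans (cong (_+ w) (toℕ-fromℕ< _)) (m∸n+n≡m (≤-trans (m≤m+n w (t * w)) (≮⇒≥ later))))
    ℓ′<bound : toℕ ℓ′ < suc t * w
    ℓ′<bound = +-cancelʳ-< w _ _ (subst₂ _<_ ℓ≡ℓ′+w (+-comm w (suc t * w)) ℓ<bound)
    nbrs-blue : ∀ u → Adj spider (foot ℓ′ r) u → BlueBy spider initial forces t u
    nbrs-blue u a with foot-neighbours a
    ... | inj₁ refl        = centre-blue t
    ... | inj₂ (r′ , refl) = blue-legs t ℓ′ r′ ℓ′<bound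

  all-blue : ∀ t → d ≤ suc t * w → AllBlueBy spider initial forces t
  all-blue t d≤ x with view x
  ... | is-centre   = centre-blue t
  ... | is-foot ℓ r = blue-legs t ℓ r (<-≤-trans (toℕ<n ℓ) d≤)


module Instance (m : ℕ) where

  p d k t₀ : ℕ
  p  = suc m
  d  = suc (p * 2) * suc (p * 2)
  k  = p * 4 + 2
  t₀ = p * 4

  1+p≤d : suc p ≤ d
  1+p≤d = subst (suc p ≤_)
    (solve 1 (λ p → con 1 :+ p :+ (p :* con 3 :+ p :* p :* con 4)
                    := (con 1 :+ p :* con 2) :* (con 1 :+ p :* con 2)) refl p)
    (m≤m+n (suc p) (p * 3 + p * p * 4))

  open Spider d 3 public using (n; spider; spider-connected; spider-isTree)
  open SpiderLosses d
  open SpiderSchedule d (suc p) (s≤s z≤n) 1+p≤d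

  legs≡k² : d * 4 ≡ k * k
  legs≡k² = solve 1 (λ p → (con 1 :+ p :* con 2) :* (con 1 :+ p :* con 2) :* con 4
                           := (p :* con 4 :+ con 2) :* (p :* con 4 :+ con 2)) refl p

  4≤k : 4 ≤ k
  4≤k = ≤-trans (*-monoˡ-≤ 4 (s≤s (z≤n {m}))) (m≤m+n (p * 4) 2)

  k<d : k < d
  k<d = subst (suc k ≤_)
    (solve 1 (λ m → con 1 :+ ((con 1 :+ m) :* con 4 :+ con 2) :+ (m :* m :* con 4 :+ m :* con 8 :+ con 2)
                    := (con 1 :+ (con 1 :+ m) :* con 2) :* (con 1 :+ (con 1 :+ m) :* con 2)) refl m)
    (m≤m+n (suc k) (m * m * 4 + m * 8 + 2))

  4∤k : ¬ 4 ∣ k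
  4∤k 4∣k = <⇒≱ (s≤s (s≤s (s≤s z≤n))) (∣⇒≤ (∣m+n∣m⇒∣n {m = p * 4} {n = 2} 4∣k (n∣m*n p)))

  covered : d ≤ suc t₀ * suc p
  covered = subst (d ≤_)
    (solve 1 (λ p → (con 1 :+ p :* con 2) :* (con 1 :+ p :* con 2) :+ p
                    := (con 1 :+ p :* con 4) :* (con 1 :+ p)) refl p)
    (m≤m+n d p)

  exact : ∣ initial ∣ + t₀ ≡ suc (k + k)
  exact = trans (cong (_+ t₀) ∣initial∣)
    (solve 1 (λ p → con 1 :+ (con 1 :+ p) :* con 4 :+ p :* con 4
                    := con 1 :+ ((p :* con 4 :+ con 2) :+ (p :* con 4 :+ con 2))) refl p)

  throttling : IsHoppingThrottling spider (suc (k + k))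
  throttling = throttling-attained spider
    (λ B F t forces → LowerBound.throttling≥ spider spider-connected (cong suc legs≡k²)
                        (≤-trans (s≤s (s≤s z≤n)) 4≤k) (λ S? → spider-loss₂ S? 4≤k k<d 4∤k) forces t)
    initial forces t₀ chronology (all-blue t₀ covered) exact

  grows : m ≤ n
  grows = ≤-trans (n≤1+n m) (≤-trans (≤-trans (n≤1+n p) 1+p≤d) (≤-trans (m≤m*n d 4) (n≤1+n (d * 4))))

  above-ceiling : ∀ j → IsCeilSqrt (4 * (n ∸ 1)) j → j < suc (k + k)
  above-ceiling j (_ , least) = s≤s (least (k + k) (≤-reflexive (begin
    4 * (d * 4)        ≡⟨ cong (4 *_) legs≡k² ⟩
    4 * (k * k)        ≡⟨ solve 1 (λ k → con 4 :* (k :* k) := (k :+ k) :* (k :+ k)) refl k ⟩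
    (k + k) * (k + k)  ∎)))
    where open ≡-Reasoning

proposition3p8 : ∀ m → Σ ℕ λ n → m ≤ n × Σ (SimpleGraph n) λ T → IsTree T ×
    Σ ℕ λ th → IsHoppingThrottling T th × (∀ k → IsCeilSqrt (4 * (n ∸ 1)) k → k < th)
proposition3p8 m = n , grows , spider , spider-isTree , suc (k + k) , throttling , above-ceiling
  where open Instance m
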